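{- Let $n\ge 6$ be even and let $C_3$ be the $(n-1)\times(n-1)$ matrix defined in the context. Let $Y$ be the $(n-1)\times(n-1)$ matrix given by $Ye^1=e^1$, $Ye^2=e^2$; for odd $k$ with $3\le k\le n-3$, $Ye^k=-F_{k-2}e^1+\sum_{i=2}^{k-1}(-1)^{i+1}F_{k-i}e^i+e^k$; for even $k$ with $4\le k\le n-4$, $Ye^k=F_{k-2}e^1+\sum_{i=2}^{k-1}(-1)^{i}F_{k-i}e^i+e^k$; $Ye^{n-2}=-F_{n-5}e^1+\sum_{i=2}^{n-4}(-1)^{i+1}F_{n-3-i}e^i+e^{n-2}$; and $Ye^{n-1}=-F_{n-5}e^1+\sum_{i=2}^{n-4}(-1)^{i+1}F_{n-3-i}e^i+e^{n-1}$. Then $Y=C_3^{ -1}$.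
   Context: $F_m$ is the $m$-th Fibonacci number, $F_1=F_2=1$, $F_{m+1}=F_m+F_{m-1}$. $e^1,\dots,e^{n-1}$ are the standard basis vectors of $\mathbb{R}^{n-1}$. $C_3$ is the $(n-1)\times(n-1)$ matrix with $C_3e^1=e^1$, $C_3e^2=e^2$; for odd $k$ with $3\le k\le n-3$, $C_3e^k=e^1+\sum_{i=1}^{(k-1)/2}e^{2i}+e^k$; for even $k$ with $4\le k\le n-4$, $C_3e^k=\sum_{i=1}^{(k-2)/2}e^{2i+1}+e^k$; $C_3e^{n-2}=e^1+\sum_{i=1}^{(n-4)/2}e^{2i}+e^{n-2}$ and $C_3e^{n-1}=e^1+\sum_{i=1}^{(n-4)/2}e^{2i}+e^{n-1}$. -}

module Defs where

open import Data.Nat as ℕ using (ℕ; zero; suc; _∸_; _≡ᵇ_; _≤ᵇ_; _%_)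
open import Data.Bool using (Bool; true; false; if_then_else_; _∧_; _∨_; not)
open import Data.Integer as ℤ using (ℤ; +_; -_; _*_; _+_)
open import Data.Fin using (Fin; toℕ)
open import Relation.Binary.PropositionalEquality using (_≡_)

F : ℕ → ℕ
F zero = zero
F (suc zero) = suc zero
F (suc (suc m)) = F (suc m) ℕ.+ F m

-- square matrices over ℤ of size d, entries indexed by Fin d (0-based;
-- the paper's 1-based row/column index is toℕ i + 1)
Mat : ℕ → Set
Mat d = Fin d → Fin d → ℤ

Σ : (d : ℕ) → (Fin d → ℤ) → ℤ
Σ zero f = + 0
Σ (suc d) f = f Data.Fin.zero + Σ d (λ l → f (Data.Fin.suc l))

_⊗_ : {d : ℕ} → Mat d → Mat d → Mat d
_⊗_ {d} A B i j = Σ d (λ l → A i l * B l j)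

I : {d : ℕ} → Mat d
I i j = if toℕ i ≡ᵇ toℕ j then + 1 else + 0

between : ℕ → ℕ → ℕ → Bool
between a b i = (a ≤ᵇ i) ∧ (i ≤ᵇ b)

isOdd : ℕ → Bool
isOdd i = i % 2 ≡ᵇ 1

isEven : ℕ → Bool
isEven i = i % 2 ≡ᵇ 0

δ : ℕ → ℕ → ℤ
δ i k = if i ≡ᵇ k then + 1 else + 0

b2z : Bool → ℤ
b2z true = + 1
b2z false = + 0

sgn : ℕ → ℤ
sgn m = if isEven m then + 1 else - (+ 1)

-- entry in row i, column k (1-based) of C₃ (size (n-1)), i.e. i-th coordinate of C₃ e^k
c3 : ℕ → ℕ → ℕ → ℤ
c3 n i k =
  if k ≡ᵇ 1 then δ i 1 else
  if k ≡ᵇ 2 then δ i 2 else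
  if (k ≡ᵇ n ∸ 2) ∨ (k ≡ᵇ n ∸ 1) then
    -- e^1 + Σ_{j=1}^{(n-4)/2} e^{2j} + e^k
    b2z ((i ≡ᵇ 1) ∨ (isEven i ∧ between 2 (n ∸ 4) i) ∨ (i ≡ᵇ k)) else
  if isOdd k ∧ between 3 (n ∸ 3) k then
    -- e^1 + Σ_{j=1}^{(k-1)/2} e^{2j} + e^k
    b2z ((i ≡ᵇ 1) ∨ (isEven i ∧ between 2 (k ∸ 1) i) ∨ (i ≡ᵇ k)) else
  if isEven k ∧ between 4 (n ∸ 4) k then
    -- Σ_{j=1}^{(k-2)/2} e^{2j+1} + e^k
    b2z ((isOdd i ∧ between 3 (k ∸ 1) i) ∨ (i ≡ᵇ k)) else
  + 0

-- entry in row i, column k (1-based) of Y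
y : ℕ → ℕ → ℕ → ℤ
y n i k =
  if k ≡ᵇ 1 then δ i 1 else
  if k ≡ᵇ 2 then δ i 2 else
  if (k ≡ᵇ n ∸ 2) ∨ (k ≡ᵇ n ∸ 1) then
    (if i ≡ᵇ 1 then - (+ F (n ∸ 5)) else
     if between 2 (n ∸ 4) i then sgn (suc i) * + F (n ∸ 3 ∸ i) else
     δ i k) else
  if isOdd k ∧ between 3 (n ∸ 3) k then
    (if i ≡ᵇ 1 then - (+ F (k ∸ 2)) else
     if between 2 (k ∸ 1) i then sgn (suc i) * + F (k ∸ i) else
     δ i k) else
  if isEven k ∧ between 4 (n ∸ 4) k then
    (if i ≡ᵇ 1 then + F (k ∸ 2) else
     if between 2 (k ∸ 1) i then sgn i * + F (k ∸ i) else
     δ i k) else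
  + 0

C₃ : (n : ℕ) → Mat (n ∸ 1)
C₃ n i k = c3 n (suc (toℕ i)) (suc (toℕ k))

Y : (n : ℕ) → Mat (n ∸ 1)
Y n i k = y n (suc (toℕ i)) (suc (toℕ k))

IsInverse : {d : ℕ} → Mat d → Mat d → Set
IsInverse {d} A B = (∀ i j → (A ⊗ B) i j ≡ I i j) Data.Product.× (∀ i j → (B ⊗ A) i j ≡ I i j)
  where import Data.Product

module Submission where

-- Write n = 2q + 6; the matrices have size D = n - 1.  Y·C₃ = I and C₃·Y = I are checked
-- one column k at a time (InverseColumns): Y sends column k of C₃ to e_k and C₃ sends
-- column k of Y to e_k.  For 2 ≤ k ≤ n - 5 the columns of C₃ obey
--     C₃e_{k+2} = C₃e_k - e_k + e_{k+1} + e_{k+2}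
-- (they are indicator vectors of alternating index sets), and those of Y obey the
-- matching inverse recurrence  Ye_{k+2} = Ye_k - Ye_{k+1} - e_k + e_{k+2},  which is the
-- Fibonacci recurrence because Ye_k has entries ±F(k - l) (fibColumn).  Under these two
-- recurrences the inverse property propagates from columns k, k+1 to k+2 (twoStep).
-- Columns 1, 2, 3 are checked directly, and the last two columns arise from column n - 3
-- by moving its diagonal unit vector (jump).

open import Defs
open import Data.Nat as ℕ using (ℕ; zero; suc; _∸_; _≡ᵇ_; _≤ᵇ_; _≤_; _<_; _≤?_; z≤n; s≤s)
import Data.Nat.Properties as ℕP
open import Data.Nat.Divisibility using (_∣_; divides)
open import Data.Bool using (Bool; true; false; T; if_then_else_; _∧_; _∨_)
open import Data.Bool.Properties using (T-≡)
open import Function.Bundles using (Equivalence)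
open import Data.Integer using (ℤ; +_; -_; _-_; _*_; _+_)
import Data.Integer.Properties as ℤP
open import Data.Integer.Tactic.RingSolver using (solve-∀)
open import Data.Fin using (toℕ)
import Data.Fin.Properties as FinP
open import Data.Product using (_,_; _×_; proj₁; proj₂)
open import Data.Empty using (⊥; ⊥-elim)
open import Relation.Nullary using (¬_; yes; no)
open import Relation.Binary.PropositionalEquality

-- dbl r = 2r, by a recursion along which the parity tests of Defs compute
dbl : ℕ → ℕ
dbl zero = zero
dbl (suc r) = suc (suc (dbl r))

data Parity : ℕ → Set where
  even : ∀ r → Parity (dbl r)
  odd  : ∀ r → Parity (suc (dbl r))

parity : ∀ m → Parity m
parity zero = even zero
parity (suc m) with parity m
... | even r = odd r
... | odd r = even (suc r)

isEven-dbl : ∀ r → isEven (dbl r) ≡ true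
isEven-dbl zero = refl
isEven-dbl (suc r) = isEven-dbl r

isEven-odd : ∀ r → isEven (suc (dbl r)) ≡ false
isEven-odd zero = refl
isEven-odd (suc r) = isEven-odd r

isOdd-dbl : ∀ r → isOdd (dbl r) ≡ false
isOdd-dbl zero = refl
isOdd-dbl (suc r) = isOdd-dbl r

isOdd-odd : ∀ r → isOdd (suc (dbl r)) ≡ true
isOdd-odd zero = refl
isOdd-odd (suc r) = isOdd-odd r

sgn-dbl : ∀ r → sgn (dbl r) ≡ + 1
sgn-dbl zero = refl
sgn-dbl (suc r) = sgn-dbl r

sgn-odd : ∀ r → sgn (suc (dbl r)) ≡ - + 1
sgn-odd zero = refl
sgn-odd (suc r) = sgn-odd r

sgn-suc : ∀ m → sgn (suc m) ≡ - sgn m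
sgn-suc m with parity m
... | even r = trans (sgn-odd r) (cong -_ (sym (sgn-dbl r)))
... | odd r = trans (sgn-dbl (suc r)) (cong -_ (sym (sgn-odd r)))

sgn-dbl+ : ∀ a m → sgn (dbl a ℕ.+ m) ≡ sgn m
sgn-dbl+ zero m = refl
sgn-dbl+ (suc a) m = sgn-dbl+ a m

sgn-j+sj : ∀ j → sgn (j ℕ.+ suc j) ≡ - + 1
sgn-j+sj zero = refl
sgn-j+sj (suc j) = trans (cong (λ x → sgn (suc x)) (ℕP.+-suc j (suc j))) (sgn-j+sj j)

*2≡dbl : ∀ k → k ℕ.* 2 ≡ dbl k
*2≡dbl zero = refl
*2≡dbl (suc k) = cong (λ x → suc (suc x)) (*2≡dbl k)

dbl-mono : ∀ {a b} → a ≤ b → dbl a ≤ dbl b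
dbl-mono z≤n = z≤n
dbl-mono (s≤s h) = s≤s (s≤s (dbl-mono h))

dbl-cancel : ∀ {a b} → dbl a ≤ suc (dbl b) → a ≤ b
dbl-cancel {zero} _ = z≤n
dbl-cancel {suc a} {suc b} (s≤s (s≤s h)) = s≤s (dbl-cancel h)

≡ᵇ-refl : ∀ m → (m ≡ᵇ m) ≡ true
≡ᵇ-refl m = Equivalence.to T-≡ (ℕP.≡⇒≡ᵇ m m refl)

≡ᵇ-false : ∀ {m n} → m < n → (m ≡ᵇ n) ≡ false
≡ᵇ-false {zero} (s≤s h) = refl
≡ᵇ-false {suc m} (s≤s h) = ≡ᵇ-false h

≤ᵇ-suc : ∀ m n → (suc m ≤ᵇ suc n) ≡ (m ≤ᵇ n)
≤ᵇ-suc zero n = refl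
≤ᵇ-suc (suc m) n = refl

≤ᵇ-true : ∀ {m n} → m ≤ n → (m ≤ᵇ n) ≡ true
≤ᵇ-true m≤n = Equivalence.to T-≡ (ℕP.≤⇒≤ᵇ m≤n)

≤ᵇ-false : ∀ {m n} → n < m → (m ≤ᵇ n) ≡ false
≤ᵇ-false {suc m} {zero} h = refl
≤ᵇ-false {suc m} {suc n} (s≤s h) = trans (≤ᵇ-suc m n) (≤ᵇ-false h)

dbl-≡ᵇ : ∀ r s → (dbl r ≡ᵇ dbl s) ≡ (r ≡ᵇ s)
dbl-≡ᵇ zero zero = refl
dbl-≡ᵇ zero (suc s) = refl
dbl-≡ᵇ (suc r) zero = refl
dbl-≡ᵇ (suc r) (suc s) = dbl-≡ᵇ r s

dbl-≢ᵇ-odd : ∀ r s → (dbl r ≡ᵇ suc (dbl s)) ≡ false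
dbl-≢ᵇ-odd zero s = refl
dbl-≢ᵇ-odd (suc r) zero = refl
dbl-≢ᵇ-odd (suc r) (suc s) = dbl-≢ᵇ-odd r s

odd-≢ᵇ-dbl : ∀ r s → (suc (dbl r) ≡ᵇ dbl s) ≡ false
odd-≢ᵇ-dbl r zero = refl
odd-≢ᵇ-dbl zero (suc s) = refl
odd-≢ᵇ-dbl (suc r) (suc s) = odd-≢ᵇ-dbl r s

dbl-≤ᵇ : ∀ r s → (dbl r ≤ᵇ dbl s) ≡ (r ≤ᵇ s)
dbl-≤ᵇ zero s = refl
dbl-≤ᵇ (suc r) zero = refl
dbl-≤ᵇ (suc r) (suc s) =
  trans (≤ᵇ-suc (suc (dbl r)) (suc (dbl s)))
        (trans (≤ᵇ-suc (dbl r) (dbl s)) (trans (dbl-≤ᵇ r s) (sym (≤ᵇ-suc r s))))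

δ-≢ : ∀ {i k} → ¬ (i ≡ k) → δ i k ≡ + 0
δ-≢ {i} {k} i≢k with i ≡ᵇ k in eq
... | true = ⊥-elim (i≢k (ℕP.≡ᵇ⇒≡ i k (subst T (sym eq) _)))
... | false = refl

δ-b2z : ∀ i k → δ i k ≡ b2z (i ≡ᵇ k)
δ-b2z i k with i ≡ᵇ k
... | true = refl
... | false = refl

-- replacing a unit vector d by e in a column, written in the form used by InverseColumns.jump
moveDiagonal : ∀ (x d e : ℤ) → x + e ≡ (x + d) - d + e
moveDiagonal = solve-∀

sumTo : (ℕ → ℤ) → ℕ → ℤ
sumTo f zero = + 0
sumTo f (suc d) = f 0 + sumTo (λ l → f (suc l)) d

Σ-sumTo : ∀ d (f : ℕ → ℤ) → Σ d (λ l → f (toℕ l)) ≡ sumTo f d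
Σ-sumTo zero f = refl
Σ-sumTo (suc d) f = cong (_+_ (f 0)) (Σ-sumTo d (λ l → f (suc l)))

sumTo-cong : ∀ d {f g : ℕ → ℤ} → (∀ l → f l ≡ g l) → sumTo f d ≡ sumTo g d
sumTo-cong zero e = refl
sumTo-cong (suc d) e = cong₂ _+_ (e 0) (sumTo-cong d (λ l → e (suc l)))

sumTo-+ : ∀ d (f g : ℕ → ℤ) → sumTo (λ l → f l + g l) d ≡ sumTo f d + sumTo g d
sumTo-+ zero f g = refl
sumTo-+ (suc d) f g =
  trans (cong (_+_ (f 0 + g 0)) (sumTo-+ d (λ l → f (suc l)) (λ l → g (suc l))))
        (interchange (f 0) (g 0) _ _)
  where
  interchange : ∀ (a b c e : ℤ) → (a + b) + (c + e) ≡ (a + c) + (b + e)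
  interchange = solve-∀

sumTo-neg : ∀ d (f : ℕ → ℤ) → sumTo (λ l → - f l) d ≡ - sumTo f d
sumTo-neg zero f = refl
sumTo-neg (suc d) f =
  trans (cong (_+_ (- f 0)) (sumTo-neg d (λ l → f (suc l))))
        (sym (ℤP.neg-distrib-+ (f 0) _))

sumTo-δ : ∀ d (f : ℕ → ℤ) m → m < d → sumTo (λ l → f l * δ l m) d ≡ f m
sumTo-δ (suc d) f zero _ = begin
  f 0 * + 1 + sumTo (λ l → f (suc l) * + 0) d
    ≡⟨ cong₂ _+_ (ℤP.*-identityʳ (f 0)) (sumTo-cong d (λ l → ℤP.*-zeroʳ (f (suc l)))) ⟩
  f 0 + sumTo (λ _ → + 0) d
    ≡⟨ cong (_+_ (f 0)) (sumTo-zero d) ⟩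
  f 0 + + 0
    ≡⟨ ℤP.+-identityʳ (f 0) ⟩
  f 0 ∎
  where
  open ≡-Reasoning
  sumTo-zero : ∀ d → sumTo (λ _ → + 0) d ≡ + 0
  sumTo-zero zero = refl
  sumTo-zero (suc d) = trans (ℤP.+-identityˡ _) (sumTo-zero d)
sumTo-δ (suc d) f (suc m) (s≤s m<d) =
  trans (cong₂ _+_ (ℤP.*-zeroʳ (f 0)) (sumTo-δ d (λ l → f (suc l)) m m<d))
        (ℤP.+-identityˡ (f (suc m)))

dot : ℕ → (ℕ → ℤ) → (ℕ → ℤ) → ℤ
dot D v w = sumTo (λ l → v (suc l) * w (suc l)) D

module DotProduct (D : ℕ) (v : ℕ → ℤ) where

  dot-cong : ∀ {w w′} → (∀ l → w l ≡ w′ l) → dot D v w ≡ dot D v w′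
  dot-cong e = sumTo-cong D (λ l → cong (v (suc l) *_) (e (suc l)))

  dot-+ : ∀ f g → dot D v (λ l → f l + g l) ≡ dot D v f + dot D v g
  dot-+ f g = trans (sumTo-cong D (λ l → ℤP.*-distribˡ-+ (v (suc l)) (f (suc l)) (g (suc l))))
                    (sumTo-+ D _ _)

  dot-neg : ∀ f → dot D v (λ l → - f l) ≡ - dot D v f
  dot-neg f = trans (sumTo-cong D (λ l → sym (ℤP.neg-distribʳ-* (v (suc l)) (f (suc l)))))
                    (sumTo-neg D _)

  dot-- : ∀ f g → dot D v (λ l → f l - g l) ≡ dot D v f - dot D v g
  dot-- f g = trans (dot-+ f (λ l → - g l)) (cong (_+_ (dot D v f)) (dot-neg g))

  dot-unit : ∀ m → m < D → dot D v (λ l → δ l (suc m)) ≡ v (suc m)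
  dot-unit m m<D = sumTo-δ D (λ l → v (suc l)) m m<D

  dot-3 : ∀ f g h → dot D v (λ l → f l - g l + h l) ≡ dot D v f - dot D v g + dot D v h
  dot-3 f g h = trans (dot-+ (λ l → f l - g l) h) (cong (_+ dot D v h) (dot-- f g))

  dot-4 : ∀ f g h k → dot D v (λ l → f l - g l + h l + k l)
                      ≡ dot D v f - dot D v g + dot D v h + dot D v k
  dot-4 f g h k = trans (dot-+ (λ l → f l - g l + h l) k) (cong (_+ dot D v k) (dot-3 f g h))

module InverseColumns (D : ℕ) (A B : ℕ → ℕ → ℤ) where
  open module Dot v = DotProduct D v

  InverseColumn : ℕ → Set
  InverseColumn k = (∀ i → dot D (λ l → A i l) (λ l → B l k) ≡ δ i k)
                  × (∀ i → dot D (λ l → B i l) (λ l → A l k) ≡ δ i k)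

  unitColumn : ∀ m → m < D → (∀ l → A l (suc m) ≡ δ l (suc m)) → (∀ l → B l (suc m) ≡ δ l (suc m)) →
    InverseColumn (suc m)
  unitColumn m m<D eA eB =
      (λ i → trans (dot-cong (λ l → A i l) eB) (trans (dot-unit (λ l → A i l) m m<D) (eA i)))
    , (λ i → trans (dot-cong (λ l → B i l) eA) (trans (dot-unit (λ l → B i l) m m<D) (eB i)))

  twoStep : ∀ m → 2 ℕ.+ m < D →
    (∀ l → B l (3 ℕ.+ m) ≡ B l (1 ℕ.+ m) - δ l (1 ℕ.+ m) + δ l (2 ℕ.+ m) + δ l (3 ℕ.+ m)) →
    (∀ l → A l (3 ℕ.+ m) ≡ A l (1 ℕ.+ m) - A l (2 ℕ.+ m) + - δ l (1 ℕ.+ m) + δ l (3 ℕ.+ m)) →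
    InverseColumn (1 ℕ.+ m) → InverseColumn (2 ℕ.+ m) → InverseColumn (3 ℕ.+ m)
  twoStep m 2+m<D recB recA (AB₀ , BA₀) (AB₁ , BA₁) = AB₂ , BA₂
    where
    open ≡-Reasoning
    m<D : m < D
    m<D = ℕP.<-trans (ℕP.n<1+n m) (ℕP.<-trans (ℕP.n<1+n (suc m)) 2+m<D)
    1+m<D : suc m < D
    1+m<D = ℕP.<-trans (ℕP.n<1+n (suc m)) 2+m<D
    j₀ j₁ j₂ : ℕ
    j₀ = 1 ℕ.+ m
    j₁ = 2 ℕ.+ m
    j₂ = 3 ℕ.+ m
    cancelAB : ∀ (d₀ a₀ a₁ d₂ : ℤ) → d₀ - a₀ + a₁ + (a₀ - a₁ + - d₀ + d₂) ≡ d₂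
    cancelAB = solve-∀
    cancelBA : ∀ (d₀ d₁ b₀ d₂ : ℤ) → d₀ - d₁ + - b₀ + (b₀ - d₀ + d₁ + d₂) ≡ d₂
    cancelBA = solve-∀
    AB₂ : ∀ i → dot D (λ l → A i l) (λ l → B l j₂) ≡ δ i j₂
    AB₂ i = begin
      dot D (A i) (λ l → B l j₂)
        ≡⟨ dot-cong (A i) recB ⟩
      dot D (A i) (λ l → B l j₀ - δ l j₀ + δ l j₁ + δ l j₂)
        ≡⟨ dot-4 (A i) (λ l → B l j₀) (λ l → δ l j₀) (λ l → δ l j₁) (λ l → δ l j₂) ⟩
      dot D (A i) (λ l → B l j₀) - dot D (A i) (λ l → δ l j₀)
        + dot D (A i) (λ l → δ l j₁) + dot D (A i) (λ l → δ l j₂)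
        ≡⟨ cong₂ (λ x y → x - y + dot D (A i) (λ l → δ l j₁) + dot D (A i) (λ l → δ l j₂))
                 (AB₀ i) (dot-unit (A i) m m<D) ⟩
      δ i j₀ - A i j₀ + dot D (A i) (λ l → δ l j₁) + dot D (A i) (λ l → δ l j₂)
        ≡⟨ cong₂ (λ x y → δ i j₀ - A i j₀ + x + y)
                 (dot-unit (A i) (suc m) 1+m<D) (dot-unit (A i) (2 ℕ.+ m) 2+m<D) ⟩
      δ i j₀ - A i j₀ + A i j₁ + A i j₂
        ≡⟨ cong (_+_ (δ i j₀ - A i j₀ + A i j₁)) (recA i) ⟩
      δ i j₀ - A i j₀ + A i j₁ + (A i j₀ - A i j₁ + - δ i j₀ + δ i j₂)
        ≡⟨ cancelAB (δ i j₀) (A i j₀) (A i j₁) (δ i j₂) ⟩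
      δ i j₂ ∎
    BA₂ : ∀ i → dot D (λ l → B i l) (λ l → A l j₂) ≡ δ i j₂
    BA₂ i = begin
      dot D (B i) (λ l → A l j₂)
        ≡⟨ dot-cong (B i) recA ⟩
      dot D (B i) (λ l → A l j₀ - A l j₁ + - δ l j₀ + δ l j₂)
        ≡⟨ dot-4 (B i) (λ l → A l j₀) (λ l → A l j₁) (λ l → - δ l j₀) (λ l → δ l j₂) ⟩
      dot D (B i) (λ l → A l j₀) - dot D (B i) (λ l → A l j₁)
        + dot D (B i) (λ l → - δ l j₀) + dot D (B i) (λ l → δ l j₂)
        ≡⟨ cong₂ (λ x y → x - y + dot D (B i) (λ l → - δ l j₀) + dot D (B i) (λ l → δ l j₂))
                 (BA₀ i) (BA₁ i) ⟩
      δ i j₀ - δ i j₁ + dot D (B i) (λ l → - δ l j₀) + dot D (B i) (λ l → δ l j₂)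
        ≡⟨ cong₂ (λ x y → δ i j₀ - δ i j₁ + x + y)
                 (trans (dot-neg (B i) (λ l → δ l j₀)) (cong -_ (dot-unit (B i) m m<D)))
                 (dot-unit (B i) (2 ℕ.+ m) 2+m<D) ⟩
      δ i j₀ - δ i j₁ + - B i j₀ + B i j₂
        ≡⟨ cong (_+_ (δ i j₀ - δ i j₁ + - B i j₀)) (recB i) ⟩
      δ i j₀ - δ i j₁ + - B i j₀ + (B i j₀ - δ i j₀ + δ i j₁ + δ i j₂)
        ≡⟨ cancelBA (δ i j₀) (δ i j₁) (B i j₀) (δ i j₂) ⟩
      δ i j₂ ∎

  thirdColumn : 2 < D →
    (∀ l → A l 1 ≡ δ l 1) → (∀ l → A l 2 ≡ δ l 2) → (∀ l → B l 1 ≡ δ l 1) → (∀ l → B l 2 ≡ δ l 2) →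
    (∀ l → B l 3 ≡ δ l 1 + δ l 2 + δ l 3) → (∀ l → A l 3 ≡ - δ l 1 - δ l 2 + δ l 3) →
    InverseColumn 3
  thirdColumn 2<D A₁ A₂ B₁ B₂ B₃ A₃ = AB , BA
    where
    open ≡-Reasoning
    0<D : 0 < D
    0<D = ℕP.<-trans (s≤s z≤n) (ℕP.<-trans (s≤s (s≤s z≤n)) 2<D)
    1<D : 1 < D
    1<D = ℕP.<-trans (s≤s (s≤s z≤n)) 2<D
    cancelAB : ∀ (d₁ d₂ d₃ : ℤ) → d₁ + d₂ + (- d₁ - d₂ + d₃) ≡ d₃
    cancelAB = solve-∀
    cancelBA : ∀ (d₁ d₂ d₃ : ℤ) → - d₁ - d₂ + (d₁ + d₂ + d₃) ≡ d₃
    cancelBA = solve-∀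
    AB : ∀ i → dot D (λ l → A i l) (λ l → B l 3) ≡ δ i 3
    AB i = begin
      dot D (A i) (λ l → B l 3)                          ≡⟨ dot-cong (A i) B₃ ⟩
      dot D (A i) (λ l → δ l 1 + δ l 2 + δ l 3)
        ≡⟨ trans (dot-+ (A i) (λ l → δ l 1 + δ l 2) (λ l → δ l 3))
                 (cong (_+ dot D (A i) (λ l → δ l 3)) (dot-+ (A i) (λ l → δ l 1) (λ l → δ l 2))) ⟩
      dot D (A i) (λ l → δ l 1) + dot D (A i) (λ l → δ l 2) + dot D (A i) (λ l → δ l 3)
        ≡⟨ cong₂ _+_ (cong₂ _+_ (trans (dot-unit (A i) 0 0<D) (A₁ i)) (trans (dot-unit (A i) 1 1<D) (A₂ i)))
                     (trans (dot-unit (A i) 2 2<D) (A₃ i)) ⟩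
      δ i 1 + δ i 2 + (- δ i 1 - δ i 2 + δ i 3)          ≡⟨ cancelAB (δ i 1) (δ i 2) (δ i 3) ⟩
      δ i 3 ∎
    BA : ∀ i → dot D (λ l → B i l) (λ l → A l 3) ≡ δ i 3
    BA i = begin
      dot D (B i) (λ l → A l 3)                          ≡⟨ dot-cong (B i) A₃ ⟩
      dot D (B i) (λ l → - δ l 1 - δ l 2 + δ l 3)
        ≡⟨ dot-3 (B i) (λ l → - δ l 1) (λ l → δ l 2) (λ l → δ l 3) ⟩
      dot D (B i) (λ l → - δ l 1) - dot D (B i) (λ l → δ l 2) + dot D (B i) (λ l → δ l 3)
        ≡⟨ cong₂ _+_ (cong₂ (λ x y → x - y)
                        (trans (dot-neg (B i) (λ l → δ l 1)) (cong -_ (trans (dot-unit (B i) 0 0<D) (B₁ i))))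
                        (trans (dot-unit (B i) 1 1<D) (B₂ i)))
                     (trans (dot-unit (B i) 2 2<D) (B₃ i)) ⟩
      - δ i 1 - δ i 2 + (δ i 1 + δ i 2 + δ i 3)          ≡⟨ cancelBA (δ i 1) (δ i 2) (δ i 3) ⟩
      δ i 3 ∎

  jump : ∀ t m → t < D → m < D →
    (∀ l → B l (suc m) ≡ B l (suc t) - δ l (suc t) + δ l (suc m)) →
    (∀ l → A l (suc m) ≡ A l (suc t) - δ l (suc t) + δ l (suc m)) →
    InverseColumn (suc t) → InverseColumn (suc m)
  jump t m t<D m<D eB eA (ABₜ , BAₜ) =
      (λ i → shift (A i) (λ l → B l (suc t)) (λ l → B l (suc m)) eB i (ABₜ i) (eA i))
    , (λ i → shift (B i) (λ l → A l (suc t)) (λ l → A l (suc m)) eA i (BAₜ i) (eB i))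
    where
    open ≡-Reasoning
    cancel : ∀ (x y z : ℤ) → x - y + (y - x + z) ≡ z
    cancel = solve-∀
    shift : ∀ (v w w′ : ℕ → ℤ) → (∀ l → w′ l ≡ w l - δ l (suc t) + δ l (suc m)) →
      ∀ i → dot D v w ≡ δ i (suc t) → v (suc m) ≡ v (suc t) - δ i (suc t) + δ i (suc m) →
      dot D v w′ ≡ δ i (suc m)
    shift v w w′ e i vw vm = begin
      dot D v w′                                          ≡⟨ dot-cong v e ⟩
      dot D v (λ l → w l - δ l (suc t) + δ l (suc m))     ≡⟨ dot-3 v w (λ l → δ l (suc t)) (λ l → δ l (suc m)) ⟩
      dot D v w - dot D v (λ l → δ l (suc t)) + dot D v (λ l → δ l (suc m))
        ≡⟨ cong₂ (λ x y → x - y + dot D v (λ l → δ l (suc m))) vw (dot-unit v t t<D) ⟩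
      δ i (suc t) - v (suc t) + dot D v (λ l → δ l (suc m))
        ≡⟨ cong (_+_ (δ i (suc t) - v (suc t))) (trans (dot-unit v m m<D) vm) ⟩
      δ i (suc t) - v (suc t) + (v (suc t) - δ i (suc t) + δ i (suc m))
        ≡⟨ cancel (δ i (suc t)) (v (suc t)) (δ i (suc m)) ⟩
      δ i (suc m) ∎

-- F(x+2-m) = F(x+1-m) + F(x-m), except for the boundary m = x+1 where F 1 = F 0 + 1
F-∸ : ∀ x m → + F (2 ℕ.+ x ∸ m) ≡ + F (1 ℕ.+ x ∸ m) + + F (x ∸ m) + δ m (suc x)
F-∸ x zero = trans (ℤP.pos-+ (F (suc x)) (F x)) (sym (ℤP.+-identityʳ _))
F-∸ zero (suc zero) = refl
F-∸ zero (suc (suc m)) = cong (λ k → + F k) (ℕP.0∸n≡0 m)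
F-∸ (suc x) (suc m) = F-∸ x m

-- The common shape of the columns 2, …, n-3 of Y:
-- (-1)^k F(k-2) in row 1 and (-1)^(k+l) F(k-l) + [l = k] in rows l ≥ 2
fibColumn : ℕ → ℕ → ℤ
fibColumn k zero = + 0
fibColumn k (suc zero) = sgn k * + F (k ∸ 2)
fibColumn k (suc (suc m)) = sgn (k ℕ.+ m) * + F (k ∸ suc (suc m)) + δ (suc (suc m)) k

-- the boundary term of F-∸ only survives in a row where the sign is -1
sgn-δ : ∀ j m → sgn (j ℕ.+ m) * δ m (suc j) ≡ - δ m (suc j)
sgn-δ j m with m ≡ᵇ suc j in eq
... | false = ℤP.*-zeroʳ (sgn (j ℕ.+ m))
... | true with ℕP.≡ᵇ⇒≡ m (suc j) (subst T (sym eq) _)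
...   | refl = cong (_* + 1) (sgn-j+sj j)

fibColumn-rec : ∀ j l → fibColumn (4 ℕ.+ j) l
  ≡ fibColumn (2 ℕ.+ j) l - fibColumn (3 ℕ.+ j) l + - δ l (2 ℕ.+ j) + δ l (4 ℕ.+ j)
fibColumn-rec j zero = refl
fibColumn-rec j (suc zero) = begin
  sgn j * + (F (1 ℕ.+ j) ℕ.+ F j)
    ≡⟨ cong (sgn j *_) (ℤP.pos-+ (F (1 ℕ.+ j)) (F j)) ⟩
  sgn j * (+ F (1 ℕ.+ j) + + F j)
    ≡⟨ row₁ (sgn j) (+ F (1 ℕ.+ j)) (+ F j) ⟩
  sgn j * + F j - (- sgn j) * + F (1 ℕ.+ j) + - + 0 + + 0
    ≡⟨ cong (λ s → sgn j * + F j - s * + F (1 ℕ.+ j) + - + 0 + + 0) (sym (sgn-suc j)) ⟩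
  sgn j * + F j - sgn (suc j) * + F (1 ℕ.+ j) + - + 0 + + 0 ∎
  where
  open ≡-Reasoning
  row₁ : ∀ (s a b : ℤ) → s * (a + b) ≡ s * b - (- s) * a + - + 0 + + 0
  row₁ = solve-∀
fibColumn-rec j (suc (suc m)) = begin
  s * + F (2 ℕ.+ j ∸ m) + δ m (2 ℕ.+ j)
    ≡⟨ cong (λ f → s * f + δ m (2 ℕ.+ j)) (F-∸ j m) ⟩
  s * (+ F (1 ℕ.+ j ∸ m) + + F (j ∸ m) + δ m (1 ℕ.+ j)) + δ m (2 ℕ.+ j)
    ≡⟨ row (+ F (1 ℕ.+ j ∸ m)) (+ F (j ∸ m)) (δ m (1 ℕ.+ j)) (δ m j) (δ m (2 ℕ.+ j)) (sgn-δ j m) ⟩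
  (s * + F (j ∸ m) + δ m j) - ((- s) * + F (1 ℕ.+ j ∸ m) + δ m (1 ℕ.+ j)) + - δ m j + δ m (2 ℕ.+ j)
    ≡⟨ cong (λ s′ → (s * + F (j ∸ m) + δ m j) - (s′ * + F (1 ℕ.+ j ∸ m) + δ m (1 ℕ.+ j))
                    + - δ m j + δ m (2 ℕ.+ j))
            (sym (sgn-suc (j ℕ.+ m))) ⟩
  (s * + F (j ∸ m) + δ m j) - (sgn (suc (j ℕ.+ m)) * + F (1 ℕ.+ j ∸ m) + δ m (1 ℕ.+ j))
    + - δ m j + δ m (2 ℕ.+ j) ∎
  where
  open ≡-Reasoning
  s : ℤ
  s = sgn (j ℕ.+ m)
  row : ∀ (a b d e₀ e₂ : ℤ) → s * d ≡ - d →
    s * (a + b + d) + e₂ ≡ (s * b + e₀) - ((- s) * a + d) + - e₀ + e₂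
  row a b d e₀ e₂ sd≡-d = begin
    s * (a + b + d) + e₂            ≡⟨ expand s a b d e₂ ⟩
    s * b + s * a + s * d + e₂      ≡⟨ cong (λ x → s * b + s * a + x + e₂) sd≡-d ⟩
    s * b + s * a + - d + e₂        ≡⟨ collect s a b d e₀ e₂ ⟩
    (s * b + e₀) - ((- s) * a + d) + - e₀ + e₂ ∎
    where
    expand : ∀ (s a b d e₂ : ℤ) → s * (a + b + d) + e₂ ≡ s * b + s * a + s * d + e₂
    expand = solve-∀
    collect : ∀ (s a b d e₀ e₂ : ℤ) → s * b + s * a + - d + e₂ ≡ (s * b + e₀) - ((- s) * a + d) + - e₀ + e₂
    collect = solve-∀

fibColumns-rec : ∀ (A : ℕ → ℕ → ℤ) j →
  (∀ l → A l (2 ℕ.+ j) ≡ fibColumn (2 ℕ.+ j) l) → (∀ l → A l (3 ℕ.+ j) ≡ fibColumn (3 ℕ.+ j) l) →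
  (∀ l → A l (4 ℕ.+ j) ≡ fibColumn (4 ℕ.+ j) l) →
  ∀ l → A l (4 ℕ.+ j) ≡ A l (2 ℕ.+ j) - A l (3 ℕ.+ j) + - δ l (2 ℕ.+ j) + δ l (4 ℕ.+ j)
fibColumns-rec A j e₂ e₃ e₄ l =
  trans (e₄ l) (trans (fibColumn-rec j l)
    (sym (cong₂ (λ x y → x - y + - δ l (2 ℕ.+ j) + δ l (4 ℕ.+ j)) (e₂ l) (e₃ l))))

-- the expressions defining the odd and even branches of y in Defs; in the odd branch the
-- Fibonacci entries stop at row top, which is k for the interior columns and n - 3 for the
-- last two columns
oddBranch : ℕ → ℕ → ℕ → ℤ
oddBranch top k i = if i ≡ᵇ 1 then - (+ F (top ∸ 2)) else
  if between 2 (top ∸ 1) i then sgn (suc i) * + F (top ∸ i) else δ i k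

evenBranch : ℕ → ℕ → ℤ
evenBranch k i = if i ≡ᵇ 1 then + F (k ∸ 2) else
  if between 2 (k ∸ 1) i then sgn i * + F (k ∸ i) else δ i k

-- rows m + 2 of both branches: rows above top carry the Fibonacci term, the others the
-- diagonal entry; the sum of both is correct everywhere since F 0 = 0 and δ vanishes off k
fibRow : ∀ s top k m → top ≤ k →
  (if between 2 (top ∸ 1) (2 ℕ.+ m) then s * + F (top ∸ (2 ℕ.+ m)) else δ (2 ℕ.+ m) k)
  ≡ s * + F (top ∸ (2 ℕ.+ m)) + δ (2 ℕ.+ m) k
fibRow s top k m top≤k with 2 ℕ.+ m ≤ᵇ top ∸ 1 in eq
... | true = sym (trans (cong (_+_ (s * + F (top ∸ (2 ℕ.+ m)))) (δ-≢ (λ e → ℕP.<-irrefl e below)))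
                        (ℤP.+-identityʳ _))
  where
  below : 2 ℕ.+ m < k
  below = ℕP.<-≤-trans (≤pred⇒< top (ℕP.≤ᵇ⇒≤ (2 ℕ.+ m) (top ∸ 1) (subst T (sym eq) _))) top≤k
    where
    ≤pred⇒< : ∀ u → 2 ℕ.+ m ≤ u ∸ 1 → 2 ℕ.+ m < u
    ≤pred⇒< (suc u) h = s≤s h
... | false = sym (begin
  s * + F (top ∸ (2 ℕ.+ m)) + δ (2 ℕ.+ m) k
    ≡⟨ cong (λ x → s * + F x + δ (2 ℕ.+ m) k) (ℕP.m≤n⇒m∸n≡0 (pred<⇒≤ top above)) ⟩
  s * + 0 + δ (2 ℕ.+ m) k
    ≡⟨ cong (_+ δ (2 ℕ.+ m) k) (ℤP.*-zeroʳ s) ⟩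
  + 0 + δ (2 ℕ.+ m) k
    ≡⟨ ℤP.+-identityˡ _ ⟩
  δ (2 ℕ.+ m) k ∎)
  where
  open ≡-Reasoning
  above : top ∸ 1 < 2 ℕ.+ m
  above = ℕP.≰⇒> (λ h → subst T eq (ℕP.≤⇒≤ᵇ h))
  pred<⇒≤ : ∀ u → u ∸ 1 < 2 ℕ.+ m → u ≤ 2 ℕ.+ m
  pred<⇒≤ zero _ = z≤n
  pred<⇒≤ (suc u) h = h

oddBranch-shift : ∀ t k l → t ≤ k →
  oddBranch (3 ℕ.+ t) (3 ℕ.+ k) l ≡ oddBranch (3 ℕ.+ t) (3 ℕ.+ t) l - δ l (3 ℕ.+ t) + δ l (3 ℕ.+ k)
oddBranch-shift t k zero _ = refl
oddBranch-shift t k (suc zero) _ = unchanged (- + F (suc t))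
  where
  unchanged : ∀ (x : ℤ) → x ≡ x - + 0 + + 0
  unchanged = solve-∀
oddBranch-shift t k (suc (suc m)) t≤k = begin
  oddBranch (3 ℕ.+ t) (3 ℕ.+ k) (2 ℕ.+ m)
    ≡⟨ fibRow s (3 ℕ.+ t) (3 ℕ.+ k) m (ℕP.+-monoʳ-≤ 3 t≤k) ⟩
  s * f + e
    ≡⟨ moveDiagonal (s * f) d e ⟩
  (s * f + d) - d + e
    ≡⟨ cong (λ x → x - d + e) (sym (fibRow s (3 ℕ.+ t) (3 ℕ.+ t) m ℕP.≤-refl)) ⟩
  oddBranch (3 ℕ.+ t) (3 ℕ.+ t) (2 ℕ.+ m) - d + e ∎
  where
  open ≡-Reasoning
  s f d e : ℤ
  s = sgn (3 ℕ.+ m)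
  f = + F (3 ℕ.+ t ∸ (2 ℕ.+ m))
  d = δ (2 ℕ.+ m) (3 ℕ.+ t)
  e = δ (2 ℕ.+ m) (3 ℕ.+ k)

oddBranch-fib : ∀ a l → oddBranch (3 ℕ.+ dbl a) (3 ℕ.+ dbl a) l ≡ fibColumn (3 ℕ.+ dbl a) l
oddBranch-fib a zero = refl
oddBranch-fib a (suc zero) =
  sym (trans (cong (_* + F (suc (dbl a))) (sgn-odd a)) (ℤP.-1*i≡-i (+ F (suc (dbl a)))))
oddBranch-fib a (suc (suc m)) =
  trans (fibRow (sgn (3 ℕ.+ m)) (3 ℕ.+ dbl a) (3 ℕ.+ dbl a) m ℕP.≤-refl)
        (cong (λ s → s * + F (3 ℕ.+ dbl a ∸ (2 ℕ.+ m)) + δ (2 ℕ.+ m) (3 ℕ.+ dbl a)) sameSign)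
  where
  sameSign : sgn (suc m) ≡ sgn (suc (dbl a ℕ.+ m))
  sameSign = trans (sym (sgn-dbl+ a (suc m))) (cong sgn (ℕP.+-suc (dbl a) m))

evenBranch-fib : ∀ a l → evenBranch (4 ℕ.+ dbl a) l ≡ fibColumn (4 ℕ.+ dbl a) l
evenBranch-fib a zero = refl
evenBranch-fib a (suc zero) =
  sym (trans (cong (_* + F (2 ℕ.+ dbl a)) (sgn-dbl a)) (ℤP.*-identityˡ (+ F (2 ℕ.+ dbl a))))
evenBranch-fib a (suc (suc m)) =
  trans (fibRow (sgn m) (4 ℕ.+ dbl a) (4 ℕ.+ dbl a) m ℕP.≤-refl)
        (cong (λ s → s * + F (4 ℕ.+ dbl a ∸ (2 ℕ.+ m)) + δ (2 ℕ.+ m) (4 ℕ.+ dbl a)) (sym (sgn-dbl+ a m)))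

fibColumn-two : ∀ l → δ l 2 ≡ fibColumn 2 l
fibColumn-two zero = refl
fibColumn-two (suc zero) = refl
fibColumn-two (suc (suc zero)) = refl
fibColumn-two (suc (suc (suc m))) = sym (cong (_+ + 0) (ℤP.*-zeroʳ (sgn (3 ℕ.+ m))))

oddIndicator : ℕ → ℕ → ℕ → ℤ
oddIndicator M k l = b2z ((l ≡ᵇ 1) ∨ (isEven l ∧ between 2 M l) ∨ (l ≡ᵇ k))

evenIndicator : ℕ → ℕ → ℕ → ℤ
evenIndicator M k l = b2z ((isOdd l ∧ between 3 M l) ∨ (l ≡ᵇ k))

b2z-∨ : ∀ x y → (T x → T y → ⊥) → b2z (x ∨ y) ≡ b2z x + b2z y
b2z-∨ false false _ = refl
b2z-∨ false true _ = refl
b2z-∨ true false _ = refl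
b2z-∨ true true x#y = ⊥-elim (x#y _ _)

b2z-∨₃ : ∀ x y z → (T x → T y → ⊥) → (T x → T z → ⊥) → (T y → T z → ⊥) →
  b2z (x ∨ y ∨ z) ≡ b2z x + b2z y + b2z z
b2z-∨₃ false false false _ _ _ = refl
b2z-∨₃ false false true _ _ _ = refl
b2z-∨₃ false true false _ _ _ = refl
b2z-∨₃ true false false _ _ _ = refl
b2z-∨₃ x true true _ _ y#z = ⊥-elim (y#z _ _)
b2z-∨₃ true true false x#y _ _ = ⊥-elim (x#y _ _)
b2z-∨₃ true false true _ x#z _ = ⊥-elim (x#z _ _)

≡ᵇ-excludes : ∀ (P : ℕ → Bool) l k → P k ≡ false → T (l ≡ᵇ k) → T (P l) → ⊥
≡ᵇ-excludes P l k Pk l≡k Pl with ℕP.≡ᵇ⇒≡ l k l≡k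
... | refl = subst T Pk Pl

evensUpTo : ℕ → ℕ → ℤ
evensUpTo b l = b2z (isEven l ∧ between 2 (dbl b) l)

oddsUpTo : ℕ → ℕ → ℤ
oddsUpTo b l = b2z (isOdd l ∧ between 3 (suc (dbl b)) l)

oddIndicator-split : ∀ b k l → (isEven (3 ℕ.+ k) ∧ between 2 (dbl b) (3 ℕ.+ k)) ≡ false →
  oddIndicator (dbl b) (3 ℕ.+ k) l ≡ δ l 1 + evensUpTo b l + δ l (3 ℕ.+ k)
oddIndicator-split b k l notEven =
  trans (b2z-∨₃ (l ≡ᵇ 1) _ (l ≡ᵇ 3 ℕ.+ k)
          (≡ᵇ-excludes (λ l → isEven l ∧ between 2 (dbl b) l) l 1 refl)
          (≡ᵇ-excludes (λ l → l ≡ᵇ 3 ℕ.+ k) l 1 refl)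
          (λ e l≡k → ≡ᵇ-excludes (λ l → isEven l ∧ between 2 (dbl b) l) l (3 ℕ.+ k) notEven l≡k e))
        (cong₂ (λ x y → x + evensUpTo b l + y) (sym (δ-b2z l 1)) (sym (δ-b2z l (3 ℕ.+ k))))

evenIndicator-split : ∀ b k l → (isOdd k ∧ between 3 (suc (dbl b)) k) ≡ false →
  evenIndicator (suc (dbl b)) k l ≡ oddsUpTo b l + δ l k
evenIndicator-split b k l notOdd =
  trans (b2z-∨ _ (l ≡ᵇ k)
          (λ o l≡k → ≡ᵇ-excludes (λ l → isOdd l ∧ between 3 (suc (dbl b)) l) l k notOdd l≡k o))
        (cong (_+_ (oddsUpTo b l)) (sym (δ-b2z l k)))

evensUpTo-even : ∀ b r → evensUpTo b (dbl (suc r)) ≡ b2z (suc r ≤ᵇ b)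
evensUpTo-even b r = cong b2z (cong₂ _∧_ (isEven-dbl r) (dbl-≤ᵇ (suc r) b))

evensUpTo-odd : ∀ b r → evensUpTo b (suc (dbl r)) ≡ + 0
evensUpTo-odd b r = cong (λ x → b2z (x ∧ between 2 (dbl b) (suc (dbl r)))) (isEven-odd r)

oddsUpTo-odd : ∀ b r → oddsUpTo b (suc (dbl (suc r))) ≡ b2z (suc r ≤ᵇ b)
oddsUpTo-odd b r =
  cong b2z (cong₂ _∧_ (isOdd-odd r) (trans (≤ᵇ-suc (dbl (suc r)) (dbl b)) (dbl-≤ᵇ (suc r) b)))

oddsUpTo-even : ∀ b r → oddsUpTo b (dbl r) ≡ + 0
oddsUpTo-even b r = cong (λ x → b2z (x ∧ between 3 (suc (dbl b)) (dbl r))) (isOdd-dbl r)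

≤ᵇ-split : ∀ r b → b2z (r ≤ᵇ suc b) ≡ b2z (r ≤ᵇ b) + b2z (r ≡ᵇ suc b)
≤ᵇ-split zero b = refl
≤ᵇ-split (suc zero) zero = refl
≤ᵇ-split (suc (suc r)) zero = refl
≤ᵇ-split (suc r) (suc b) =
  trans (cong b2z (≤ᵇ-suc r (suc b)))
        (trans (≤ᵇ-split r b) (cong (λ x → b2z x + b2z (r ≡ᵇ suc b)) (sym (≤ᵇ-suc r b))))

δ-dbl : ∀ r s → δ (dbl r) (dbl s) ≡ b2z (r ≡ᵇ s)
δ-dbl r s = trans (δ-b2z (dbl r) (dbl s)) (cong b2z (dbl-≡ᵇ r s))

evensUpTo-zero : ∀ l → evensUpTo 0 l ≡ + 0
evensUpTo-zero l with parity l
... | even zero = refl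
... | even (suc r) = evensUpTo-even 0 r
... | odd r = evensUpTo-odd 0 r

evensUpTo-suc : ∀ b l → evensUpTo (suc b) l ≡ evensUpTo b l + δ l (dbl (suc b))
evensUpTo-suc b l with parity l
... | even zero = refl
... | even (suc r) =
  trans (evensUpTo-even (suc b) r)
        (trans (≤ᵇ-split (suc r) b)
               (sym (cong₂ _+_ (evensUpTo-even b r) (δ-dbl (suc r) (suc b)))))
... | odd r =
  trans (evensUpTo-odd (suc b) r)
        (sym (cong₂ _+_ (evensUpTo-odd b r)
                        (cong (λ x → if x then + 1 else + 0) (odd-≢ᵇ-dbl r (suc b)))))

oddsUpTo-zero : ∀ l → oddsUpTo 0 l ≡ + 0
oddsUpTo-zero l with parity l
... | even r = oddsUpTo-even 0 r
... | odd zero = refl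
... | odd (suc r) = oddsUpTo-odd 0 r

oddsUpTo-suc : ∀ b l → oddsUpTo (suc b) l ≡ oddsUpTo b l + δ l (suc (dbl (suc b)))
oddsUpTo-suc b l with parity l
... | even r =
  trans (oddsUpTo-even (suc b) r)
        (sym (cong₂ _+_ (oddsUpTo-even b r)
                        (cong (λ x → if x then + 1 else + 0) (dbl-≢ᵇ-odd r (suc b)))))
... | odd zero = refl
... | odd (suc r) =
  trans (oddsUpTo-odd (suc b) r)
        (trans (≤ᵇ-split (suc r) b)
               (sym (cong₂ _+_ (oddsUpTo-odd b r) (δ-dbl (suc r) (suc b)))))

lastColumn? oddInterior? evenInterior? : ℕ → ℕ → Bool
lastColumn? n k = (k ≡ᵇ n ∸ 2) ∨ (k ≡ᵇ n ∸ 1)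
oddInterior? n k = isOdd k ∧ between 3 (n ∸ 3) k
evenInterior? n k = isEven k ∧ between 4 (n ∸ 4) k

c3-oddBranch : ∀ t k l → lastColumn? (6 ℕ.+ t) (3 ℕ.+ k) ≡ false → oddInterior? (6 ℕ.+ t) (3 ℕ.+ k) ≡ true →
  c3 (6 ℕ.+ t) l (3 ℕ.+ k) ≡ oddIndicator (2 ℕ.+ k) (3 ℕ.+ k) l
c3-oddBranch t k l notLast interior rewrite notLast | interior = refl

y-oddBranch : ∀ t k l → lastColumn? (6 ℕ.+ t) (3 ℕ.+ k) ≡ false → oddInterior? (6 ℕ.+ t) (3 ℕ.+ k) ≡ true →
  y (6 ℕ.+ t) l (3 ℕ.+ k) ≡ oddBranch (3 ℕ.+ k) (3 ℕ.+ k) l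
y-oddBranch t k l notLast interior rewrite notLast | interior = refl

c3-evenBranch : ∀ t k l → lastColumn? (6 ℕ.+ t) (3 ℕ.+ k) ≡ false → oddInterior? (6 ℕ.+ t) (3 ℕ.+ k) ≡ false →
  evenInterior? (6 ℕ.+ t) (3 ℕ.+ k) ≡ true → c3 (6 ℕ.+ t) l (3 ℕ.+ k) ≡ evenIndicator (2 ℕ.+ k) (3 ℕ.+ k) l
c3-evenBranch t k l notLast notOdd interior rewrite notLast | notOdd | interior = refl

y-evenBranch : ∀ t k l → lastColumn? (6 ℕ.+ t) (3 ℕ.+ k) ≡ false → oddInterior? (6 ℕ.+ t) (3 ℕ.+ k) ≡ false →
  evenInterior? (6 ℕ.+ t) (3 ℕ.+ k) ≡ true → y (6 ℕ.+ t) l (3 ℕ.+ k) ≡ evenBranch (3 ℕ.+ k) l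
y-evenBranch t k l notLast notOdd interior rewrite notLast | notOdd | interior = refl

c3-lastBranch : ∀ t k l → lastColumn? (6 ℕ.+ t) (3 ℕ.+ k) ≡ true →
  c3 (6 ℕ.+ t) l (3 ℕ.+ k) ≡ oddIndicator (2 ℕ.+ t) (3 ℕ.+ k) l
c3-lastBranch t k l last rewrite last = refl

y-lastBranch : ∀ t k l → lastColumn? (6 ℕ.+ t) (3 ℕ.+ k) ≡ true →
  y (6 ℕ.+ t) l (3 ℕ.+ k) ≡ oddBranch (3 ℕ.+ t) (3 ℕ.+ k) l
y-lastBranch t k l last rewrite last = refl

module ForSize (q : ℕ) where
  N D : ℕ
  N = 6 ℕ.+ dbl q
  D = 5 ℕ.+ dbl q

  open InverseColumns D (y N) (c3 N)

  notLast-odd : ∀ a → a ≤ q → lastColumn? N (3 ℕ.+ dbl a) ≡ false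
  notLast-odd a a≤q = cong₂ _∨_ (dbl-≢ᵇ-odd a q) (trans (dbl-≡ᵇ a (suc q)) (≡ᵇ-false (s≤s a≤q)))

  interior-odd : ∀ a → a ≤ q → oddInterior? N (3 ℕ.+ dbl a) ≡ true
  interior-odd a a≤q = cong₂ _∧_ (isOdd-odd a) (≤ᵇ-true (ℕP.+-monoʳ-≤ 3 (dbl-mono a≤q)))

  notLast-even : ∀ a → suc a ≤ q → lastColumn? N (4 ℕ.+ dbl a) ≡ false
  notLast-even a a<q = cong₂ _∨_ (trans (dbl-≡ᵇ a q) (≡ᵇ-false a<q)) (dbl-≢ᵇ-odd a q)

  notOdd-even : ∀ a M → (isOdd (4 ℕ.+ dbl a) ∧ between 3 M (4 ℕ.+ dbl a)) ≡ false
  notOdd-even a M = cong (λ x → x ∧ between 3 M (4 ℕ.+ dbl a)) (isOdd-dbl a)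

  interior-even : ∀ a → suc a ≤ q → evenInterior? N (4 ℕ.+ dbl a) ≡ true
  interior-even a a<q = cong₂ _∧_ (isEven-dbl a) (≤ᵇ-true (ℕP.+-monoʳ-≤ 2 (dbl-mono a<q)))

  last₄ : lastColumn? N (4 ℕ.+ dbl q) ≡ true
  last₄ = cong (_∨ (dbl q ≡ᵇ suc (dbl q))) (≡ᵇ-refl (dbl q))

  last₅ : lastColumn? N (5 ℕ.+ dbl q) ≡ true
  last₅ = cong₂ _∨_ (odd-≢ᵇ-dbl q q) (≡ᵇ-refl (dbl q))

  c3-evenColumn : ∀ a → a ≤ q → ∀ l → c3 N l (2 ℕ.+ dbl a) ≡ oddsUpTo a l + δ l (2 ℕ.+ dbl a)
  c3-evenColumn zero _ l = sym (trans (cong (_+ δ l 2) (oddsUpTo-zero l)) (ℤP.+-identityˡ (δ l 2)))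
  c3-evenColumn (suc a) a<q l =
    trans (c3-evenBranch (dbl q) (suc (dbl a)) l (notLast-even a a<q) (notOdd-even a (3 ℕ.+ dbl q)) (interior-even a a<q))
          (evenIndicator-split (suc a) (4 ℕ.+ dbl a) l (notOdd-even a (3 ℕ.+ dbl a)))

  c3-oddColumn : ∀ a → a ≤ q → ∀ l → c3 N l (3 ℕ.+ dbl a) ≡ δ l 1 + evensUpTo (suc a) l + δ l (3 ℕ.+ dbl a)
  c3-oddColumn a a≤q l =
    trans (c3-oddBranch (dbl q) (dbl a) l (notLast-odd a a≤q) (interior-odd a a≤q))
          (oddIndicator-split (suc a) (dbl a) l
            (cong (λ x → x ∧ between 2 (dbl (suc a)) (3 ℕ.+ dbl a)) (isEven-odd a)))

  c3-lastColumn : ∀ k → lastColumn? N (3 ℕ.+ k) ≡ true →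
    (isEven (3 ℕ.+ k) ∧ between 2 (dbl (suc q)) (3 ℕ.+ k)) ≡ false →
    ∀ l → c3 N l (3 ℕ.+ k) ≡ c3 N l (3 ℕ.+ dbl q) - δ l (3 ℕ.+ dbl q) + δ l (3 ℕ.+ k)
  c3-lastColumn k last notEven l =
    trans (c3-lastBranch (dbl q) k l last)
    (trans (oddIndicator-split (suc q) k l notEven)
    (trans (moveDiagonal (δ l 1 + evensUpTo (suc q) l) (δ l (3 ℕ.+ dbl q)) (δ l (3 ℕ.+ k)))
           (cong (λ x → x - δ l (3 ℕ.+ dbl q) + δ l (3 ℕ.+ k)) (sym (c3-oddColumn q ℕP.≤-refl l)))))

  c3-third : ∀ l → c3 N l 3 ≡ δ l 1 + δ l 2 + δ l 3
  c3-third l = trans (c3-oddColumn 0 z≤n l)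
    (cong (λ x → δ l 1 + x + δ l 3)
          (trans (evensUpTo-suc 0 l) (trans (cong (_+ δ l 2) (evensUpTo-zero l)) (ℤP.+-identityˡ (δ l 2)))))

  c3-rec-even : ∀ a → suc a ≤ q → ∀ l →
    c3 N l (4 ℕ.+ dbl a) ≡ c3 N l (2 ℕ.+ dbl a) - δ l (2 ℕ.+ dbl a) + δ l (3 ℕ.+ dbl a) + δ l (4 ℕ.+ dbl a)
  c3-rec-even a a<q l = begin
    c3 N l (4 ℕ.+ dbl a)                                 ≡⟨ c3-evenColumn (suc a) a<q l ⟩
    oddsUpTo (suc a) l + d₄                              ≡⟨ cong (_+ d₄) (oddsUpTo-suc a l) ⟩
    oddsUpTo a l + d₃ + d₄                               ≡⟨ replaceUnit (oddsUpTo a l) d₂ d₃ d₄ ⟩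
    oddsUpTo a l + d₂ - d₂ + d₃ + d₄
      ≡⟨ cong (λ x → x - d₂ + d₃ + d₄) (sym (c3-evenColumn a (ℕP.<⇒≤ a<q) l)) ⟩
    c3 N l (2 ℕ.+ dbl a) - d₂ + d₃ + d₄ ∎
    where
    open ≡-Reasoning
    d₂ d₃ d₄ : ℤ
    d₂ = δ l (2 ℕ.+ dbl a)
    d₃ = δ l (3 ℕ.+ dbl a)
    d₄ = δ l (4 ℕ.+ dbl a)
    replaceUnit : ∀ (x d₂ d₃ d₄ : ℤ) → x + d₃ + d₄ ≡ x + d₂ - d₂ + d₃ + d₄
    replaceUnit = solve-∀

  c3-rec-odd : ∀ a → suc a ≤ q → ∀ l →
    c3 N l (5 ℕ.+ dbl a) ≡ c3 N l (3 ℕ.+ dbl a) - δ l (3 ℕ.+ dbl a) + δ l (4 ℕ.+ dbl a) + δ l (5 ℕ.+ dbl a)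
  c3-rec-odd a a<q l = begin
    c3 N l (5 ℕ.+ dbl a)                                 ≡⟨ c3-oddColumn (suc a) a<q l ⟩
    δ l 1 + evensUpTo (2 ℕ.+ a) l + d₅                   ≡⟨ cong (λ x → δ l 1 + x + d₅) (evensUpTo-suc (suc a) l) ⟩
    δ l 1 + (evensUpTo (suc a) l + d₄) + d₅              ≡⟨ replaceUnit (δ l 1) (evensUpTo (suc a) l) d₃ d₄ d₅ ⟩
    δ l 1 + evensUpTo (suc a) l + d₃ - d₃ + d₄ + d₅
      ≡⟨ cong (λ x → x - d₃ + d₄ + d₅) (sym (c3-oddColumn a (ℕP.<⇒≤ a<q) l)) ⟩
    c3 N l (3 ℕ.+ dbl a) - d₃ + d₄ + d₅ ∎
    where
    open ≡-Reasoning
    d₃ d₄ d₅ : ℤ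
    d₃ = δ l (3 ℕ.+ dbl a)
    d₄ = δ l (4 ℕ.+ dbl a)
    d₅ = δ l (5 ℕ.+ dbl a)
    replaceUnit : ∀ (x e d₃ d₄ d₅ : ℤ) → x + (e + d₄) + d₅ ≡ x + e + d₃ - d₃ + d₄ + d₅
    replaceUnit = solve-∀

  y-oddColumn : ∀ a → a ≤ q → ∀ l → y N l (3 ℕ.+ dbl a) ≡ fibColumn (3 ℕ.+ dbl a) l
  y-oddColumn a a≤q l =
    trans (y-oddBranch (dbl q) (dbl a) l (notLast-odd a a≤q) (interior-odd a a≤q)) (oddBranch-fib a l)

  y-evenColumn : ∀ a → a ≤ q → ∀ l → y N l (2 ℕ.+ dbl a) ≡ fibColumn (2 ℕ.+ dbl a) l
  y-evenColumn zero _ l = fibColumn-two l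
  y-evenColumn (suc a) a<q l =
    trans (y-evenBranch (dbl q) (suc (dbl a)) l (notLast-even a a<q) (notOdd-even a (3 ℕ.+ dbl q)) (interior-even a a<q))
          (evenBranch-fib a l)

  y-lastColumn : ∀ k → lastColumn? N (3 ℕ.+ k) ≡ true → dbl q ≤ k →
    ∀ l → y N l (3 ℕ.+ k) ≡ y N l (3 ℕ.+ dbl q) - δ l (3 ℕ.+ dbl q) + δ l (3 ℕ.+ k)
  y-lastColumn k last q≤k l =
    trans (y-lastBranch (dbl q) k l last)
    (trans (oddBranch-shift (dbl q) k l q≤k)
           (cong (λ x → x - δ l (3 ℕ.+ dbl q) + δ l (3 ℕ.+ k))
                 (sym (y-oddBranch (dbl q) (dbl q) l (notLast-odd q ℕP.≤-refl) (interior-odd q ℕP.≤-refl)))))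

  y-third : ∀ l → y N l 3 ≡ - δ l 1 - δ l 2 + δ l 3
  y-third zero = refl
  y-third (suc zero) = refl
  y-third (suc (suc zero)) = refl
  y-third (suc (suc (suc zero))) = refl
  y-third (suc (suc (suc (suc l)))) = refl

  interior : ∀ a → a ≤ q → InverseColumn (2 ℕ.+ dbl a) × InverseColumn (3 ℕ.+ dbl a)
  interior zero _ =
      unitColumn 1 (s≤s (s≤s z≤n)) (λ _ → refl) (λ _ → refl)
    , thirdColumn (s≤s (s≤s (s≤s z≤n))) (λ _ → refl) (λ _ → refl) (λ _ → refl) (λ _ → refl) c3-third y-third
  interior (suc a) a<q = column₄ , column₅
    where
    a≤q : a ≤ q
    a≤q = ℕP.<⇒≤ a<q
    previous : InverseColumn (2 ℕ.+ dbl a) × InverseColumn (3 ℕ.+ dbl a)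
    previous = interior a a≤q
    4+a<D : 4 ℕ.+ dbl a < D
    4+a<D = ℕP.≤-trans (ℕP.+-monoʳ-≤ 3 (dbl-mono a<q)) (ℕP.m≤n+m (3 ℕ.+ dbl q) 2)
    column₄ : InverseColumn (4 ℕ.+ dbl a)
    column₄ = twoStep (1 ℕ.+ dbl a) (ℕP.<-trans (ℕP.n<1+n _) 4+a<D) (c3-rec-even a a<q)
      (fibColumns-rec (y N) (dbl a) (y-evenColumn a a≤q) (y-oddColumn a a≤q) (y-evenColumn (suc a) a<q))
      (proj₁ previous) (proj₂ previous)
    column₅ : InverseColumn (5 ℕ.+ dbl a)
    column₅ = twoStep (2 ℕ.+ dbl a) 4+a<D (c3-rec-odd a a<q)
      (fibColumns-rec (y N) (1 ℕ.+ dbl a) (y-oddColumn a a≤q) (y-evenColumn (suc a) a<q) (y-oddColumn (suc a) a<q))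
      (proj₂ previous) column₄

  columnT<D : 2 ℕ.+ dbl q < D
  columnT<D = ℕP.m≤n+m (3 ℕ.+ dbl q) 2

  secondLast : InverseColumn (4 ℕ.+ dbl q)
  secondLast = jump (2 ℕ.+ dbl q) (3 ℕ.+ dbl q) columnT<D (ℕP.n≤1+n (4 ℕ.+ dbl q))
    (c3-lastColumn (suc (dbl q)) last₄
      (cong₂ _∧_ (isEven-dbl q) (≤ᵇ-false (ℕP.<-trans (ℕP.n<1+n _) (ℕP.n<1+n (3 ℕ.+ dbl q))))))
    (y-lastColumn (suc (dbl q)) last₄ (ℕP.n≤1+n (dbl q)))
    (proj₂ (interior q ℕP.≤-refl))

  last : InverseColumn (5 ℕ.+ dbl q)
  last = jump (2 ℕ.+ dbl q) (4 ℕ.+ dbl q) columnT<D ℕP.≤-refl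
    (c3-lastColumn (2 ℕ.+ dbl q) last₅
      (cong (λ x → x ∧ between 2 (dbl (suc q)) (5 ℕ.+ dbl q)) (isEven-odd q)))
    (y-lastColumn (2 ℕ.+ dbl q) last₅ (ℕP.≤-trans (ℕP.n≤1+n _) (ℕP.n≤1+n _)))
    (proj₂ (interior q ℕP.≤-refl))

  column : ∀ m → m < D → InverseColumn (suc m)
  column zero _ = unitColumn 0 (s≤s z≤n) (λ _ → refl) (λ _ → refl)
  column (suc j) (s≤s (s≤s j≤3+2q)) with parity j
  ... | even a with a ≤? q
  ...   | yes a≤q = proj₁ (interior a a≤q)
  ...   | no a≰q = subst (λ b → InverseColumn (2 ℕ.+ dbl b)) (sym a≡1+q) secondLast
    where
    a≡1+q : a ≡ suc q
    a≡1+q = ℕP.≤-antisym (dbl-cancel j≤3+2q) (ℕP.≰⇒> a≰q)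
  column (suc j) (s≤s (s≤s j≤3+2q)) | odd a with a ≤? q
  ...   | yes a≤q = proj₂ (interior a a≤q)
  ...   | no a≰q = subst (λ b → InverseColumn (3 ℕ.+ dbl b)) (sym a≡1+q) last
    where
    a≡1+q : a ≡ suc q
    a≡1+q = ℕP.≤-antisym (dbl-cancel (ℕP.m≤n⇒m≤1+n (ℕP.≤-pred j≤3+2q))) (ℕP.≰⇒> a≰q)

  inverse : IsInverse (Y N) (C₃ N)
  inverse =
      (λ i j → trans (Σ-sumTo D (λ l → y N (suc (toℕ i)) (suc l) * c3 N (suc l) (suc (toℕ j))))
                     (proj₁ (column (toℕ j) (FinP.toℕ<n j)) (suc (toℕ i))))
    , (λ i j → trans (Σ-sumTo D (λ l → c3 N (suc (toℕ i)) (suc l) * y N (suc l) (suc (toℕ j))))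
                     (proj₂ (column (toℕ j) (FinP.toℕ<n j)) (suc (toℕ i))))

lemma2p3 : (n : ℕ) → 6 ≤ n → 2 ∣ n → IsInverse (Y n) (C₃ n)
lemma2p3 n 6≤n (divides k refl) =
  subst (λ m → IsInverse (Y m) (C₃ m)) (sym (*2≡dbl k)) (evenSize k (subst (6 ≤_) (*2≡dbl k) 6≤n))
  where
  evenSize : ∀ k → 6 ≤ dbl k → IsInverse (Y (dbl k)) (C₃ (dbl k))
  evenSize 1 (s≤s (s≤s ()))
  evenSize 2 (s≤s (s≤s (s≤s (s≤s ()))))
  evenSize (suc (suc (suc q))) _ = ForSize.inverse q
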